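{- Some sentences of $\mathsf{InqBT}+[x]$ are not equivalent to any sentence of standard first-order logic; i.e., there is a sentence $\psi$ of $\mathsf{InqBT}+[x]$ such that no first-order sentence $\theta$ in the same vocabulary satisfies, for all models $\mathcal{M}$, $\mathcal{M}\models\psi$ iff $\mathcal{M}\models\theta$ (Tarskian truth).
   Context: Syntax of $\mathsf{InqBT}+[x]$: $\phi ::= p \mid \bot \mid (\phi\wedge\phi)\mid(\phi\veebar\phi)\mid(\phi\to\phi)\mid\forall x\phi\mid\exists^{\mathrm{i}}x\phi\mid[x]\phi$, with $p$ first-order atoms. A model $\mathcal{M}=(D,I)$ is an ordinary first-order structure. A team $X$ is a set of assignments with common variable domain; $X[x\mapsto d]=\{g[x\mapsto d]: g\in X\}$, $X[x\mapsto D]=\{g[x\mapsto d]: g\in X, d\in D\}$. Support: atoms supported iff true under every $g\in X$; $\bot$ iff $X=\emptyset$; $\wedge$ conjunction; $\phi\veebar\psi$ iff $\phi$ or $\psi$ supported; $\phi\to\psi$ iff every $Y\subseteq X$ supporting $\phi$ supports $\psi$; $\forall x\phi$ iff $X[x\mapsto d]$ supports $\phi$ for all $d\in D$; $\exists^{\mathrm{i}}x\phi$ iff for some $d\in D$; $[x]\phi$ iff $X[x\mapsto D]$ supports $\phi$. For a sentence, $\mathcal{M}\models\phi$ means it is supported by some (equivalently every) non-empty team. -}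

module Defs where

open import Level using (Level; Lift; 0ℓ; suc)
open import Data.Nat using (ℕ; _≡ᵇ_)
open import Data.Bool using (if_then_else_)
open import Data.Fin using (Fin)
open import Data.Product using (Σ; ∃; _×_; _,_)
open import Data.Sum using (_⊎_)
open import Data.Empty using (⊥)
open import Relation.Nullary using (¬_)
open import Relation.Binary.PropositionalEquality using (_≡_)

record Signature : Set₁ where
  field
    Fun      : Set
    funArity : Fun → ℕ
    Rel      : Set
    relArity : Rel → ℕ
open Signature public

data Term (S : Signature) : Set where
  var : ℕ → Term S
  app : (f : Fun S) → (Fin (funArity S f) → Term S) → Term S

data Atom (S : Signature) : Set where
  rel : (R : Rel S) → (Fin (relArity S R) → Term S) → Atom S
  eq  : Term S → Term S → Atom S

record Structure (S : Signature) : Set₁ where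
  field
    Dom  : Set
    elem : Dom
    funI : (f : Fun S) → (Fin (funArity S f) → Dom) → Dom
    relI : (R : Rel S) → (Fin (relArity S R) → Dom) → Set
open Structure public

module _ {S : Signature} (M : Structure S) where

  Assignment : Set
  Assignment = ℕ → Dom M

  update : Assignment → ℕ → Dom M → Assignment
  update g x d n = if n ≡ᵇ x then d else g n

  evalT : Term S → Assignment → Dom M
  evalT (var x)    g = g x
  evalT (app f ts) g = funI M f (λ i → evalT (ts i) g)

  AtomTrue : Atom S → Assignment → Set
  AtomTrue (rel R ts) g = relI M R (λ i → evalT (ts i) g)
  AtomTrue (eq t u)   g = evalT t g ≡ evalT u g

FreeT : {S : Signature} → ℕ → Term S → Set
FreeT x (var y)    = x ≡ y
FreeT x (app f ts) = ∃ λ i → FreeT x (ts i)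

FreeA : {S : Signature} → ℕ → Atom S → Set
FreeA x (rel R ts) = ∃ λ i → FreeT x (ts i)
FreeA x (eq t u)   = FreeT x t ⊎ FreeT x u

data FO (S : Signature) : Set where
  atom : Atom S → FO S
  ⊥'   : FO S
  _∧'_ : FO S → FO S → FO S
  _∨'_ : FO S → FO S → FO S
  _⇒'_ : FO S → FO S → FO S
  ∀'   : ℕ → FO S → FO S
  ∃'   : ℕ → FO S → FO S

FreeFO : {S : Signature} → ℕ → FO S → Set
FreeFO x (atom a) = FreeA x a
FreeFO x ⊥'       = ⊥
FreeFO x (φ ∧' ψ) = FreeFO x φ ⊎ FreeFO x ψ
FreeFO x (φ ∨' ψ) = FreeFO x φ ⊎ FreeFO x ψ
FreeFO x (φ ⇒' ψ) = FreeFO x φ ⊎ FreeFO x ψ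
FreeFO x (∀' y φ) = ¬ (x ≡ y) × FreeFO x φ
FreeFO x (∃' y φ) = ¬ (x ≡ y) × FreeFO x φ

SentenceFO : {S : Signature} → FO S → Set
SentenceFO θ = ∀ x → ¬ FreeFO x θ

module _ {S : Signature} (M : Structure S) where

  Sat : FO S → Assignment M → Set
  Sat (atom a) g = AtomTrue M a g
  Sat ⊥'       g = ⊥
  Sat (φ ∧' ψ) g = Sat φ g × Sat ψ g
  Sat (φ ∨' ψ) g = Sat φ g ⊎ Sat ψ g
  Sat (φ ⇒' ψ) g = Sat φ g → Sat ψ g
  Sat (∀' x φ) g = ∀ d → Sat φ (update M g x d)
  Sat (∃' x φ) g = ∃ λ d → Sat φ (update M g x d)

  -- truth of a (sentence) in M: satisfied by an (arbitrary, fixed) assignment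
  _⊨FO_ : FO S → Set
  _⊨FO_ θ = Sat θ (λ _ → elem M)

data Inq (S : Signature) : Set where
  atom : Atom S → Inq S
  ⊥ᵢ   : Inq S
  _∧ᵢ_ : Inq S → Inq S → Inq S
  _⩒_  : Inq S → Inq S → Inq S
  _⇒ᵢ_ : Inq S → Inq S → Inq S
  ∀ᵢ   : ℕ → Inq S → Inq S
  ∃ⁱ   : ℕ → Inq S → Inq S
  [_]_ : ℕ → Inq S → Inq S

FreeI : {S : Signature} → ℕ → Inq S → Set
FreeI x (atom a) = FreeA x a
FreeI x ⊥ᵢ       = ⊥
FreeI x (φ ∧ᵢ ψ) = FreeI x φ ⊎ FreeI x ψ
FreeI x (φ ⩒ ψ)  = FreeI x φ ⊎ FreeI x ψ
FreeI x (φ ⇒ᵢ ψ) = FreeI x φ ⊎ FreeI x ψ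
FreeI x (∀ᵢ y φ) = ¬ (x ≡ y) × FreeI x φ
FreeI x (∃ⁱ y φ) = ¬ (x ≡ y) × FreeI x φ
FreeI x ([ y ] φ) = ¬ (x ≡ y) × FreeI x φ

SentenceI : {S : Signature} → Inq S → Set
SentenceI ψ = ∀ x → ¬ FreeI x ψ

module _ {S : Signature} (M : Structure S) where

  Team : Set₁
  Team = Assignment M → Set

  _⊆_ : Team → Team → Set
  Y ⊆ X = ∀ g → Y g → X g

  NonEmpty : Team → Set
  NonEmpty X = ∃ λ g → X g

  extend : Team → ℕ → Dom M → Team
  extend X x d g = ∃ λ h → X h × (∀ n → g n ≡ update M h x d n)

  extendAll : Team → ℕ → Team
  extendAll X x g = ∃ λ h → ∃ λ d → X h × (∀ n → g n ≡ update M h x d n)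

  Supp : Inq S → Team → Set₁
  Supp (atom a) X = Lift (suc 0ℓ) (∀ g → X g → AtomTrue M a g)
  Supp ⊥ᵢ       X = Lift (suc 0ℓ) (∀ g → ¬ X g)
  Supp (φ ∧ᵢ ψ) X = Supp φ X × Supp ψ X
  Supp (φ ⩒ ψ)  X = Supp φ X ⊎ Supp ψ X
  Supp (φ ⇒ᵢ ψ) X = ∀ (Y : Team) → Y ⊆ X → Supp φ Y → Supp ψ Y
  Supp (∀ᵢ x φ) X = ∀ d → Supp φ (extend X x d)
  Supp (∃ⁱ x φ) X = ∃ λ d → Supp φ (extend X x d)
  Supp ([ x ] φ) X = Supp φ (extendAll X x)

  _⊨I_ : Inq S → Set₁
  _⊨I_ ψ = ∃ λ (X : Team) → NonEmpty X × Supp ψ X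

-- Read in team semantics, ψ = [x₀][x₁](=(x₁, x₀) ∧ ∃z. x₁ ≠ z → ∃z. x₀ ≠ z)
-- says that every relation R(x₀, x₁) in which x₀ is a function of x₁ and x₁
-- omits a value also has x₀ omitting a value; that is, no injection of the
-- domain into itself misses a point.  Classically ψ holds in every finite
-- model, and the successor refutes it in ℕ.  A first-order sentence over the
-- empty vocabulary with k variables cannot tell apart two models with more
-- than k elements: the equality pattern of the current values of the k
-- variables can be copied into the other model one quantifier at a time.
-- So no such sentence is true in Fin (1 + k) but false in ℕ.

module Submission where

open import Defs hiding (_⊆_)
open import Level using (0ℓ; suc; Lift; lift; lower)
open import Axiom.ExcludedMiddle using (ExcludedMiddle)
open import Data.Bool using (true; false)
open import Data.Empty using (⊥)
open import Data.Fin as Fin using (Fin; punchOut)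
open import Data.Fin.Properties using (pigeonhole; punchOut-injective; <⇒≢; ¬∀⟶∃¬)
open import Data.List using (List; []; _∷_; _++_; length; map)
open import Data.List.Extrema.Nat using (max; xs≤max)
open import Data.List.Membership.Propositional using (_∈_; _∉_; find; lose)
open import Data.List.Membership.Propositional.Properties using (∈-map⁺)
open import Data.List.Membership.Setoid.Properties using (index-injective)
open import Data.List.Properties using (length-map)
open import Data.List.Relation.Binary.Subset.Propositional using (_⊆_)
open import Data.List.Relation.Binary.Subset.Propositional.Properties
  using (⊆-refl; ⊆-trans; xs⊆xs++ys; xs⊆ys++xs; xs⊆x∷xs)
open import Data.List.Relation.Unary.All as All using ()
open import Data.List.Relation.Unary.Any using (here; there; any?; index)
open import Data.Nat as ℕ using (ℕ; _≤_; _≡ᵇ_; s≤s; pred)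
open import Data.Nat.Properties using (≡ᵇ⇒≡; ≡⇒≡ᵇ; ≤-reflexive; n≮n; n<1+n)
open import Data.Product as Product using (Σ; ∃; _×_; _,_; proj₁; proj₂)
open import Data.Sum as Sum using (_⊎_; inj₁; inj₂; [_,_]′)
open import Data.Unit using (⊤; tt)
open import Function using (_∘_)
open import Function.Bundles using (_⇔_; mk⇔; Equivalence)
open import Function.Definitions using (Injective)
open import Relation.Binary.Definitions using (DecidableEquality)
open import Relation.Binary.PropositionalEquality
  using (_≡_; _≢_; refl; sym; trans; cong; cong₂; subst; subst₂; setoid; module ≡-Reasoning)
open import Relation.Nullary using (¬_; Dec; yes; no; contradiction; ¬?)
open import Relation.Nullary.Decidable using (_×-dec_; map′; decidable-stable)

open Equivalence using (to; from)

module _ {S : Signature} (M : Structure S) where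

  update-≡ : ∀ g x d → update M g x d x ≡ d
  update-≡ g x d with x ≡ᵇ x | ≡⇒≡ᵇ x x refl
  ... | true | _ = refl

  update-≢ : ∀ g {x} d {n} → n ≢ x → update M g x d n ≡ g n
  update-≢ g {x} d {n} n≢x with n ≡ᵇ x | ≡ᵇ⇒≡ n x
  ... | false | _ = refl
  ... | true | n≡x = contradiction (n≡x _) n≢x

EmptySignature : Signature
EmptySignature = record { Fun = ⊥ ; funArity = λ () ; Rel = ⊥ ; relArity = λ () }

bare : (A : Set) → A → Structure EmptySignature
bare A a = record { Dom = A ; elem = a ; funI = λ () ; relI = λ () }

FinModel : ℕ → Structure EmptySignature
FinModel n = bare (Fin (ℕ.suc n)) Fin.zero

ℕModel : Structure EmptySignature
ℕModel = bare ℕ 0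

MoreThan : ℕ → Set → Set
MoreThan k A = (L : List A) → length L ≤ k → ∃ λ a → a ∉ L

ℕ-moreThan : ∀ k → MoreThan k ℕ
ℕ-moreThan _ L _ = ℕ.suc (max 0 L) , λ m∈L → n≮n _ (All.lookup (xs≤max 0 L) m∈L)

Fin-moreThan : ∀ n → MoreThan n (Fin (ℕ.suc n))
Fin-moreThan n L |L|≤n = ¬∀⟶∃¬ _ (_∈ L) (λ i → any? (i Fin.≟_) L) λ all∈L →
  let i , j , i<j , same-index = pigeonhole (s≤s |L|≤n) (index ∘ all∈L)
  in <⇒≢ i<j (index-injective (setoid _) (all∈L i) (all∈L j) same-index)

module _ {A B : Set} where

  Compatible : A × B → A × B → Set
  Compatible (a , b) (a′ , b′) = a ≡ a′ ⇔ b ≡ b′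

  compatible-refl : ∀ {p} → Compatible p p
  compatible-refl = mk⇔ (λ _ → refl) (λ _ → refl)

  compatible-sym : ∀ {p q} → Compatible p q → Compatible q p
  compatible-sym c = mk⇔ (sym ∘ to c ∘ sym) (sym ∘ from c ∘ sym)

record SameEqualities {S : Signature} (A B : Structure S)
                      (V : List ℕ) (g : Assignment A) (h : Assignment B) : Set where
  constructor sameEqualities
  field compatible : ∀ {u v} → u ∈ V → v ∈ V → Compatible (g u , h u) (g v , h v)
open SameEqualities

sameEqualities-sym : ∀ {S} {A B : Structure S} {V g h} →
                     SameEqualities A B V g h → SameEqualities B A V h g
sameEqualities-sym same = sameEqualities λ u∈V v∈V →
  mk⇔ (from (compatible same u∈V v∈V)) (to (compatible same u∈V v∈V))

module _ {S : Signature} {A B : Structure S} (_≟_ : DecidableEquality (Dom A))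
         {V : List ℕ} (more : MoreThan (length V) (Dom B))
         {g : Assignment A} {h : Assignment B} (same : SameEqualities A B V g h)
         (y : ℕ) (a : Dom A) where

  -- b is the h-value of a variable that g sends to a, or a fresh value if there is none.
  partner : ∃ λ b → ∀ {w} → w ∈ V → w ≢ y → Compatible (a , b) (g w , h w)
  partner with any? (λ w → ¬? (w ℕ.≟ y) ×-dec (g w ≟ a)) V
  ... | yes named =
    let w , w∈V , _ , gw≡a = find named
    in h w , λ w′∈V _ → subst (λ c → Compatible (c , h w) _) gw≡a (compatible same w∈V w′∈V)
  ... | no unnamed =
    let b , b-fresh = more (map h V) (≤-reflexive (length-map h V))
    in b , λ w∈V w≢y → mk⇔
         (λ a≡gw → contradiction (lose w∈V (w≢y , sym a≡gw)) unnamed)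
         (λ b≡hw → contradiction (subst (_∈ map h V) (sym b≡hw) (∈-map⁺ h w∈V)) b-fresh)

  sameEqualities-update : ∃ λ b → SameEqualities A B V (update A g y a) (update B h y b)
  sameEqualities-update with partner
  ... | b , b-partner = b , sameEqualities compatible′
    where
    g′ : Assignment A
    g′ = update A g y a

    h′ : Assignment B
    h′ = update B h y b

    updated : ∀ u → (g′ u , h′ u) ≡ (a , b) ⊎ (u ≢ y × (g′ u , h′ u) ≡ (g u , h u))
    updated u with u ℕ.≟ y
    ... | yes refl = inj₁ (cong₂ _,_ (update-≡ A g u a) (update-≡ B h u b))
    ... | no u≢y = inj₂ (u≢y , cong₂ _,_ (update-≢ A g a u≢y) (update-≢ B h b u≢y))

    compatible′ : ∀ {u v} → u ∈ V → v ∈ V → Compatible (g′ u , h′ u) (g′ v , h′ v)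
    compatible′ {u} {v} u∈V v∈V with updated u | updated v
    ... | inj₁ p | inj₁ q = subst₂ Compatible (sym p) (sym q) compatible-refl
    ... | inj₁ p | inj₂ (v≢y , q) = subst₂ Compatible (sym p) (sym q) (b-partner v∈V v≢y)
    ... | inj₂ (u≢y , p) | inj₁ q =
      subst₂ Compatible (sym p) (sym q) (compatible-sym (b-partner u∈V u≢y))
    ... | inj₂ (_ , p) | inj₂ (_ , q) =
      subst₂ Compatible (sym p) (sym q) (compatible same u∈V v∈V)

vars : FO EmptySignature → List ℕ
vars (atom (eq (var u) (var v))) = u ∷ v ∷ []
vars ⊥' = []
vars (φ ∧' χ) = vars φ ++ vars χ
vars (φ ∨' χ) = vars φ ++ vars χ
vars (φ ⇒' χ) = vars φ ++ vars χ
vars (∀' y φ) = y ∷ vars φ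
vars (∃' y φ) = y ∷ vars φ

record Large {S : Signature} (k : ℕ) (M : Structure S) : Set where
  constructor large
  field
    decEq    : DecidableEquality (Dom M)
    moreThan : MoreThan k (Dom M)
open Large

sat-transfer : ∀ A B {V} → Large (length V) A → Large (length V) B →
               ∀ θ → vars θ ⊆ V → ∀ {g h} → SameEqualities A B V g h → Sat A θ g → Sat B θ h
sat-transfer A B lA lB (atom (eq (var u) (var v))) θ⊆V same =
  to (compatible same (θ⊆V (here refl)) (θ⊆V (there (here refl))))
sat-transfer A B lA lB ⊥' _ _ ()
sat-transfer A B lA lB (φ ∧' χ) θ⊆V same =
  Product.map (sat-transfer A B lA lB φ (⊆-trans (xs⊆xs++ys _ _) θ⊆V) same)
              (sat-transfer A B lA lB χ (⊆-trans (xs⊆ys++xs _ _) θ⊆V) same)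
sat-transfer A B lA lB (φ ∨' χ) θ⊆V same =
  Sum.map (sat-transfer A B lA lB φ (⊆-trans (xs⊆xs++ys _ _) θ⊆V) same)
          (sat-transfer A B lA lB χ (⊆-trans (xs⊆ys++xs _ _) θ⊆V) same)
sat-transfer A B lA lB (φ ⇒' χ) θ⊆V same φ⇒χ =
  sat-transfer A B lA lB χ (⊆-trans (xs⊆ys++xs _ _) θ⊆V) same
  ∘ φ⇒χ
  ∘ sat-transfer B A lB lA φ (⊆-trans (xs⊆xs++ys _ _) θ⊆V) (sameEqualities-sym same)
sat-transfer A B lA lB (∀' y φ) θ⊆V same ∀φ b =
  let a , same′ = sameEqualities-update (decEq lB) (moreThan lA) (sameEqualities-sym same) y b
  in sat-transfer A B lA lB φ (⊆-trans (xs⊆x∷xs _ y) θ⊆V) (sameEqualities-sym same′) (∀φ a)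
sat-transfer A B lA lB (∃' y φ) θ⊆V same (a , φa) =
  let b , same′ = sameEqualities-update (decEq lA) (moreThan lB) same y a
  in b , sat-transfer A B lA lB φ (⊆-trans (xs⊆x∷xs _ y) θ⊆V) same′ φa

-- θ need not be a sentence: truth is taken at a constant assignment.
⊨FO-transfer : ∀ {A B} θ → Large (length (vars θ)) A → Large (length (vars θ)) B →
               A ⊨FO θ → B ⊨FO θ
⊨FO-transfer θ lA lB = sat-transfer _ _ lA lB θ ⊆-refl (sameEqualities λ _ _ → compatible-refl)

Fin-large : ∀ n → Large n (FinModel n)
Fin-large n = large Fin._≟_ (Fin-moreThan n)

ℕ-large : ∀ k → Large k ℕModel
ℕ-large k = large ℕ._≟_ (ℕ-moreThan k)

decide : ExcludedMiddle (suc 0ℓ) → (P : Set) → Dec P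
decide em P = map′ lower lift (em {Lift (suc 0ℓ) P})

DedekindFinite : Set → Set
DedekindFinite A = (f : A → A) → Injective _≡_ _≡_ f → (a : A) → ¬ (∀ x → f x ≢ a)

Fin-dedekindFinite : ∀ {n} → DedekindFinite (Fin n)
Fin-dedekindFinite {ℕ.suc n} f f-injective a f≢a =
  let a≢f : ∀ x → a ≢ f x
      a≢f x = f≢a x ∘ sym
      i , j , i<j , same = pigeonhole (n<1+n n) (punchOut ∘ a≢f)
  in <⇒≢ i<j (f-injective (punchOut-injective (a≢f i) (a≢f j) same))

module _ {S : Signature} where

  _≐_ : ℕ → ℕ → Inq S
  x ≐ y = atom (eq (var x) (var y))

  ¬ᵢ_ : Inq S → Inq S
  ¬ᵢ φ = φ ⇒ᵢ ⊥ᵢ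

  -- The dependence atom =(x, y); 2 and 3 serve as bound variables.
  dep : ℕ → ℕ → Inq S
  dep x y = ∀ᵢ 2 ((x ≐ 2) ⇒ᵢ ∃ⁱ 3 (y ≐ 3))

  omits : ℕ → Inq S
  omits x = ∃ⁱ 2 (¬ᵢ (x ≐ 2))

  dedekindFinite : Inq S
  dedekindFinite = [ 0 ] ([ 1 ] ((dep 1 0 ∧ᵢ omits 1) ⇒ᵢ omits 0))

  free-dep : ∀ {z x y} → FreeI z (dep x y) → z ≡ x ⊎ z ≡ y
  free-dep (_ , inj₁ (inj₁ z≡x)) = inj₁ z≡x
  free-dep (z≢2 , inj₁ (inj₂ z≡2)) = contradiction z≡2 z≢2
  free-dep (_ , inj₂ (_ , inj₁ z≡y)) = inj₂ z≡y
  free-dep (_ , inj₂ (z≢3 , inj₂ z≡3)) = contradiction z≡3 z≢3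

  free-omits : ∀ {z x} → FreeI z (omits x) → z ≡ x
  free-omits (_ , inj₁ (inj₁ z≡x)) = z≡x
  free-omits (z≢2 , inj₁ (inj₂ z≡2)) = contradiction z≡2 z≢2

  dedekindFinite-sentence : SentenceI dedekindFinite
  dedekindFinite-sentence z (z≢0 , z≢1 , inj₁ (inj₁ free)) = [ z≢1 , z≢0 ]′ (free-dep free)
  dedekindFinite-sentence z (z≢0 , z≢1 , inj₁ (inj₂ free)) = z≢1 (free-omits free)
  dedekindFinite-sentence z (z≢0 , z≢1 , inj₂ free) = z≢0 (free-omits free)

module _ {S : Signature} (M : Structure S) where

  Determines : Team M → ℕ → ℕ → Set
  Determines R x y = ∀ {g g′} → R g → R g′ → g x ≡ g′ x → g y ≡ g′ y

  Omits : Team M → ℕ → Dom M → Set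
  Omits R x d = ∀ {g} → R g → g x ≢ d

  _∩[_≐_] : Team M → ℕ → ℕ → Team M
  (X ∩[ x ≐ y ]) g = X g × g x ≡ g y

  supp-⇒-restrict : ∀ {X x y φ} → Supp M ((x ≐ y) ⇒ᵢ φ) X → Supp M φ (X ∩[ x ≐ y ])
  supp-⇒-restrict {X} {x} {y} x≐y⇒φ = x≐y⇒φ (X ∩[ x ≐ y ]) (λ _ → proj₁) (lift λ _ → proj₂)

  extend-member : ∀ {X x d g} → extend M X x d g →
                  ∃ λ h → X h × g x ≡ d × (∀ {n} → n ≢ x → g n ≡ h n)
  extend-member {x = x} {d} (h , Xh , g≗) =
    h , Xh , trans (g≗ x) (update-≡ M h x d) , λ n≢x → trans (g≗ _) (update-≢ M h d n≢x)

  dep⇒determines : ∀ {x y R} → x ≢ 2 → y ≢ 2 → y ≢ 3 → Supp M (dep x y) R → Determines R x y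
  dep⇒determines {x} {y} {R} x≢2 y≢2 y≢3 dep-xy {g} {g′} Rg Rg′ gx≡g′x =
    trans (value-of-y Rg refl) (sym (value-of-y Rg′ (sym gx≡g′x)))
    where
    c : Dom M
    c = g x

    witness : ∃ λ e → Supp M (y ≐ 3) (extend M (extend M R 2 c ∩[ x ≐ 2 ]) 3 e)
    witness = supp-⇒-restrict {φ = ∃ⁱ 3 (y ≐ 3)} (dep-xy c)

    value-of-y : ∀ {f} → R f → f x ≡ c → f y ≡ proj₁ witness
    value-of-y {f} Rf fx≡c = begin
      f y                     ≡⟨ sym (update-≢ M f c y≢2) ⟩
      f₂ y                    ≡⟨ sym (update-≢ M f₂ e y≢3) ⟩
      update M f₂ 3 e y       ≡⟨ lower (proj₂ witness) _ f₃∈ ⟩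
      e                       ∎
      where
      open ≡-Reasoning
      e : Dom M
      e = proj₁ witness

      f₂ : Assignment M
      f₂ = update M f 2 c

      f₃∈ : extend M (extend M R 2 c ∩[ x ≐ 2 ]) 3 e (update M f₂ 3 e)
      f₃∈ = f₂ , ((f , Rf , λ _ → refl) , trans (update-≢ M f c x≢2) fx≡c) , λ _ → refl

  graph⇒dep : ∀ {x y R} → x ≢ 2 → y ≢ 2 → y ≢ 3 → (F : Dom M → Dom M) →
              (∀ {g} → R g → g y ≡ F (g x)) → Supp M (dep x y) R
  graph⇒dep {x} {y} x≢2 y≢2 y≢3 F graph d Y Y⊆ (lift Y⊨x≐2) = F d , lift λ k k∈ →
    let j , Yj , k3≡Fd , k≈j = extend-member k∈
        i , Ri , j2≡d , j≈i = extend-member (Y⊆ j Yj)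
        open ≡-Reasoning
    in begin
      k y      ≡⟨ k≈j y≢3 ⟩
      j y      ≡⟨ j≈i y≢2 ⟩
      i y      ≡⟨ graph Ri ⟩
      F (i x)  ≡⟨ cong F (sym (j≈i x≢2)) ⟩
      F (j x)  ≡⟨ cong F (Y⊨x≐2 j Yj) ⟩
      F (j 2)  ≡⟨ cong F j2≡d ⟩
      F d      ≡⟨ sym k3≡Fd ⟩
      k 3      ∎

  omits⇒omitted : ∀ {x R} → x ≢ 2 → Supp M (omits x) R → ∃ (Omits R x)
  omits⇒omitted {x} x≢2 (d , ¬x≐2) = d , λ {g} Rg gx≡d →
    lower (supp-⇒-restrict {φ = ⊥ᵢ} ¬x≐2) (update M g 2 d)
      ((g , Rg , λ _ → refl) , trans (update-≢ M g d x≢2) gx≡d)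

  omitted⇒omits : ∀ {x R} → x ≢ 2 → ∃ (Omits R x) → Supp M (omits x) R
  omitted⇒omits {x} x≢2 (d , omitted) = d , λ Y Y⊆ (lift Y⊨x≐2) → lift λ k Yk →
    let g , Rg , k2≡d , k≈g = extend-member (Y⊆ k Yk)
    in omitted Rg (trans (sym (k≈g x≢2)) (trans (Y⊨x≐2 k Yk) k2≡d))

  module _ (em : ExcludedMiddle (suc 0ℓ)) where

    -- If x took every value, choosing for each value a witness and reading off y
    -- would give an injection of Dom M into itself that misses o.
    omitted-value : DedekindFinite (Dom M) → ∀ {R x y o} →
                    Determines R y x → Omits R y o → ∃ (Omits R x)
    omitted-value finite {R} {x} {y} {o} x-by-y y-omits-o with decide em (∃ (Omits R x))
    ... | yes omitted = omitted
    ... | no ¬omitted = contradiction (y-omits-o ∘ R-witness) (finite f f-injective o)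
      where
      witness : ∀ d → ∃ λ g → R g × g x ≡ d
      witness d = decidable-stable (decide em _) λ ¬witness →
        ¬omitted (d , λ Rg gx≡d → ¬witness (_ , Rg , gx≡d))

      R-witness : ∀ d → R (proj₁ (witness d))
      R-witness d = proj₁ (proj₂ (witness d))

      f : Dom M → Dom M
      f d = proj₁ (witness d) y

      f-injective : Injective _≡_ _≡_ f
      f-injective {d} {d′} fd≡fd′ = begin
        d                        ≡⟨ sym (proj₂ (proj₂ (witness d))) ⟩
        proj₁ (witness d) x      ≡⟨ x-by-y (R-witness d) (R-witness d′) fd≡fd′ ⟩
        proj₁ (witness d′) x     ≡⟨ proj₂ (proj₂ (witness d′)) ⟩
        d′                       ∎
        where open ≡-Reasoning

    dedekindFinite-valid : DedekindFinite (Dom M) → ∀ X → Supp M dedekindFinite X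
    dedekindFinite-valid finite X R _ (dep₁₀ , omits₁) =
      omitted⇒omits (λ ()) (omitted-value finite
        (dep⇒determines (λ ()) (λ ()) (λ ()) dep₁₀) (proj₂ (omits⇒omitted (λ ()) omits₁)))

  dedekindFinite-refuted : (s p : Dom M → Dom M) → (∀ d → p (s d) ≡ d) →
                           (o : Dom M) → (∀ d → s d ≢ o) → ¬ (M ⊨I dedekindFinite)
  dedekindFinite-refuted s p p∘s≡id o s≢o (X , (h , Xh) , valid) =
    let d , omitted = omits⇒omitted (λ ()) (valid graph graph⊆ (dep₁₀ , omits₁))
    in omitted (d , λ _ → refl) refl
    where
    graph : Team M
    graph g = ∃ λ d → ∀ n → g n ≡ update M (update M h 0 d) 1 (s d) n

    graph⊆ : ∀ g → graph g → extendAll M (extendAll M X 0) 1 g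
    graph⊆ g (d , g≗) = update M h 0 d , s d , (h , d , Xh , λ _ → refl) , g≗

    dep₁₀ : Supp M (dep 1 0) graph
    dep₁₀ = graph⇒dep (λ ()) (λ ()) (λ ()) p λ (d , g≗) →
      trans (g≗ 0) (sym (trans (cong p (g≗ 1)) (p∘s≡id d)))

    omits₁ : Supp M (omits 1) graph
    omits₁ = omitted⇒omits (λ ()) (o , λ (d , g≗) g1≡o → s≢o d (trans (sym (g≗ 1)) g1≡o))

Fin-satisfies : ExcludedMiddle (suc 0ℓ) → ∀ n → FinModel n ⊨I dedekindFinite
Fin-satisfies em n =
  (λ _ → ⊤) , ((λ _ → Fin.zero) , tt) , dedekindFinite-valid (FinModel n) em Fin-dedekindFinite _

ℕ-refutes : ¬ (ℕModel ⊨I dedekindFinite)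
ℕ-refutes = dedekindFinite-refuted ℕModel ℕ.suc pred (λ _ → refl) 0 (λ _ ())

corollary1 : ExcludedMiddle (suc 0ℓ) →
    Σ Signature λ S → Σ (Inq S) λ ψ → SentenceI ψ ×
      ((θ : FO S) → SentenceFO θ →
        ¬ ((M : Structure S) → ((M ⊨I ψ → M ⊨FO θ) × (M ⊨FO θ → M ⊨I ψ))))
corollary1 em =
  EmptySignature , dedekindFinite , dedekindFinite-sentence {EmptySignature} , λ θ _ θ-defines →
    let n = length (vars θ)
        Fin⊨θ = proj₁ (θ-defines (FinModel n)) (Fin-satisfies em n)
        ℕ⊨θ = ⊨FO-transfer θ (Fin-large n) (ℕ-large n) Fin⊨θ
    in ℕ-refutes (proj₂ (θ-defines ℕModel) ℕ⊨θ)
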